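{- Let $m=T^3+T+1\in\mathbb{F}_2[T]$. For every integer $N\ge2$ with $N\equiv1\pmod 7$, $$\pi(N;m,1)=\pi(N;m,T)=\pi(N;m,T+1)\quad\text{and}\quad \pi(N;m,T^2)=\pi(N;m,T^2+T)=\pi(N;m,T^2+T+1).$$
   Context: For a monic $m\in\mathbb{F}_q[T]$ and $c$ coprime to $m$, $\pi(N;m,c)$ denotes the number of monic irreducible polynomials in $\mathbb{F}_q[T]$ of degree $N$ that are congruent to $c$ modulo $m$. -}

module Defs where

open import Data.Bool using (Bool; true; false; _xor_; _∧_; not; if_then_else_)
open import Data.Nat using (ℕ; zero; suc; _∸_; _≤ᵇ_; _≡ᵇ_)
open import Data.List using (List; []; _∷_; _++_; length; foldr; concatMap; upTo; map)
open import Data.Vec using (Vec; toList)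
import Data.Vec as V

-- Polynomials over F₂ = Bool (with xor as addition, ∧ as multiplication),
-- represented as coefficient lists, constant term first.
-- Canonical (normalised) form: no trailing 'false' (zero polynomial = []).
Poly : Set
Poly = List Bool

norm : Poly → Poly
norm [] = []
norm (a ∷ p) with norm p
... | [] = if a then true ∷ [] else []
... | q@(_ ∷ _) = a ∷ q

_⊕_ : Poly → Poly → Poly
[] ⊕ q = q
(a ∷ p) ⊕ [] = a ∷ p
(a ∷ p) ⊕ (b ∷ q) = (a xor b) ∷ (p ⊕ q)

_⊛_ : Poly → Poly → Poly
[] ⊛ q = []
(a ∷ p) ⊛ q = (if a then q else []) ⊕ (false ∷ (p ⊛ q))

_==_ : Poly → Poly → Bool
[] == [] = true
[] == (_ ∷ _) = false
(_ ∷ _) == [] = false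
(a ∷ p) == (b ∷ q) = (if a then b else not b) ∧ (p == q)

-- degree of a normalised nonzero polynomial (deg of [] is set to 0, unused)
deg : Poly → ℕ
deg p = length p ∸ 1

-- Remainder of f modulo a monic m (long division, Horner scheme over the
-- coefficients of f from the top down): r ↦ T·r + a, then subtract m if
-- the degree reached deg m.
remStep : Poly → Bool → Poly → Poly
remStep m a r with norm (a ∷ r)
... | s = if length s ≡ᵇ length m then norm (s ⊕ m) else s

_rem_ : Poly → Poly → Poly
f rem m = foldr (remStep m) [] f

congᵇ : Poly → Poly → Poly → Bool
congᵇ f c m = norm ((f ⊕ c) rem m) == []

allVecs : (n : ℕ) → List (Vec Bool n)
allVecs zero = V.[] ∷ []
allVecs (suc n) = concatMap (λ v → (false V.∷ v) ∷ (true V.∷ v) ∷ []) (allVecs n)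

monicOf : {n : ℕ} → Vec Bool n → Poly
monicOf v = toList v ++ (true ∷ [])

monics : ℕ → List Poly
monics n = map monicOf (allVecs n)

anyᵇ : {A : Set} → (A → Bool) → List A → Bool
anyᵇ P [] = false
anyᵇ P (x ∷ xs) = if P x then true else anyᵇ P xs

-- f (monic of degree n) is reducible iff f = g·h with g, h monic
-- of degrees d and n - d, 1 ≤ d ≤ n - 1.  (Over F₂ every nonzero
-- polynomial is monic and the only unit is 1.)
reducibleᵇ : Poly → Bool
reducibleᵇ f =
  anyᵇ (λ d → anyᵇ (λ g → anyᵇ (λ h → (g ⊛ h) == f) (monics (deg f ∸ suc d)))
                   (monics (suc d)))
       (upTo (deg f ∸ 1))

irreducibleᵇ : Poly → Bool
irreducibleᵇ f = (1 ≤ᵇ deg f) ∧ not (reducibleᵇ f)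

countᵇ : {A : Set} → (A → Bool) → List A → ℕ
countᵇ P [] = zero
countᵇ P (x ∷ xs) = if P x then suc (countᵇ P xs) else countᵇ P xs

π : ℕ → Poly → Poly → ℕ
π N m c = countᵇ (λ f → irreducibleᵇ f ∧ congᵇ f c m) (monics N)

mPoly : Poly
mPoly = true ∷ true ∷ false ∷ true ∷ []

one T T+1 T² T²+T T²+T+1 : Poly
one = true ∷ []
T = false ∷ true ∷ []
T+1 = true ∷ true ∷ []
T² = false ∷ false ∷ true ∷ []
T²+T = false ∷ true ∷ true ∷ []
T²+T+1 = true ∷ true ∷ true ∷ []

{-# OPTIONS --safe #-}
-- Let α be the class of T in F₈ = F₂[T]/(T³ + T + 1); it has order 7 and (α + 1)/α = α².
-- The map ψ f = T^N f((T+1)/T) is multiplicative on polynomials of degree ≤ N and has order 3,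
-- because x ↦ (x+1)/x does. Hence it sends monic irreducibles of degree N ≥ 2 injectively to
-- monic irreducibles of degree N (the degree cannot drop, or T + 1 would divide f). The residue
-- of ψ f is α^N f(α²) = α^N f(α)², which is α f(α)² when N ≡ 1 (mod 7). The map c ↦ α c²
-- permutes the residue classes in the 3-cycles 1 → α → α+1 → 1 and α² → α²+α+1 → α²+α → α²,
-- so each count is at most the next one along its cycle, and all counts on a cycle agree.
module Submission where

open import Defs
open import Algebra.Bundles using (CommutativeMonoid)
open import Data.Bool using (Bool; true; false; not; _xor_; _∧_; if_then_else_) renaming (T to IsTrue)
open import Data.Bool.Properties using (xor-assoc; xor-comm; xor-identityʳ; xor-same; T-∧) renaming (_≟_ to _≟ᵇ_)
open import Data.Empty using (⊥-elim)
open import Data.List using (List; []; _∷_; length; foldr; filter; map; concatMap; upTo)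
open import Data.List.Properties using (foldr-fusion; length-removeAt′; ∷-injectiveˡ; ∷-injectiveʳ) renaming (≡-dec to ≡-dec-List)
open import Data.List.Membership.Propositional using (_∈_)
open import Data.List.Membership.Propositional.Properties using (∈-map⁺; ∈-map⁻; ∈-filter⁺; ∈-filter⁻; ∈-concatMap⁺; ∈-concatMap⁻; ∈-upTo⁺; ∈-upTo⁻)
open import Data.List.Relation.Unary.Any using (here; there; index; _─_)
import Data.List.Relation.Unary.Any as Any
import Data.List.Relation.Unary.All as All
open import Data.List.Relation.Unary.AllPairs using ([]; _∷_)
open import Data.List.Relation.Unary.Unique.Propositional using (Unique)
import Data.List.Relation.Unary.Unique.Propositional.Properties as Unique
open import Data.Nat using (ℕ; zero; suc; pred; _+_; _*_; _∸_; _≤_; _<_; z≤n; s≤s; _%_; _/_)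
import Data.Nat.Properties as ℕ
open import Data.Nat.DivMod using (m≡m%n+[m/n]*n)
open import Data.Product using (_×_; _,_; proj₁; proj₂; ∃-syntax)
open import Data.Product.Properties using (≡-dec)
open import Data.Sum using (_⊎_; inj₁; inj₂)
open import Data.Unit using (tt)
open import Data.Vec using (Vec) renaming ([] to []ᵛ; _∷_ to _∷ᵛ_)
open import Function.Bundles using (Equivalence; _⇔_; mk⇔)
open import Level using (0ℓ)
open import Relation.Binary.Bundles using (Setoid)
open import Relation.Binary.Definitions using (DecidableEquality)
open import Relation.Binary.PropositionalEquality
import Relation.Binary.Reasoning.Setoid as SetoidReasoning
open import Relation.Nullary using (¬_)
open import Relation.Nullary.Decidable using (Dec; map′; _×-dec_; _→-dec_; from-yes; T?)

-- Polynomials over F₂ up to trailing zeros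

coef : Poly → ℕ → Bool
coef []      _       = false
coef (a ∷ p) zero    = a
coef (a ∷ p) (suc i) = coef p i

infix 4 _≋_
record _≋_ (p q : Poly) : Set where
  constructor coefwise
  field coef-≡ : ∀ i → coef p i ≡ coef q i
open _≋_

≋-refl : ∀ {p} → p ≋ p
≋-refl = coefwise λ _ → refl

≋-reflexive : ∀ {p q} → p ≡ q → p ≋ q
≋-reflexive refl = ≋-refl

≋-sym : ∀ {p q} → p ≋ q → q ≋ p
≋-sym p≋q = coefwise λ i → sym (coef-≡ p≋q i)

≋-trans : ∀ {p q r} → p ≋ q → q ≋ r → p ≋ r
≋-trans p≋q q≋r = coefwise λ i → trans (coef-≡ p≋q i) (coef-≡ q≋r i)

≋-setoid : Setoid 0ℓ 0ℓ
≋-setoid = record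
  { Carrier = Poly ; _≈_ = _≋_
  ; isEquivalence = record { refl = ≋-refl ; sym = ≋-sym ; trans = ≋-trans } }

module ≋-Reasoning = SetoidReasoning ≋-setoid

∷-cong : ∀ {a b p q} → a ≡ b → p ≋ q → a ∷ p ≋ b ∷ q
∷-cong a≡b p≋q = coefwise λ { zero → a≡b ; (suc i) → coef-≡ p≋q i }

∷-injective : ∀ {a b p q} → a ∷ p ≋ b ∷ q → a ≡ b × p ≋ q
∷-injective h = coef-≡ h zero , coefwise λ i → coef-≡ h (suc i)

∷≋[] : ∀ {a p} → a ∷ p ≋ [] → a ≡ false × p ≋ []
∷≋[] h = coef-≡ h zero , coefwise λ i → coef-≡ h (suc i)

false∷≋[] : ∀ {p} → p ≋ [] → false ∷ p ≋ []
false∷≋[] p≋[] = coefwise λ { zero → refl ; (suc i) → coef-≡ p≋[] i }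

coef-⊕ : ∀ p q i → coef (p ⊕ q) i ≡ coef p i xor coef q i
coef-⊕ []      q       i       = refl
coef-⊕ (a ∷ p) []      i       = sym (xor-identityʳ _)
coef-⊕ (a ∷ p) (b ∷ q) zero    = refl
coef-⊕ (a ∷ p) (b ∷ q) (suc i) = coef-⊕ p q i

⊕-cong : ∀ {p p′ q q′} → p ≋ p′ → q ≋ q′ → p ⊕ q ≋ p′ ⊕ q′
⊕-cong {p} {p′} {q} {q′} p≋p′ q≋q′ = coefwise λ i → begin
  coef (p ⊕ q) i          ≡⟨ coef-⊕ p q i ⟩
  coef p i xor coef q i   ≡⟨ cong₂ _xor_ (coef-≡ p≋p′ i) (coef-≡ q≋q′ i) ⟩
  coef p′ i xor coef q′ i ≡⟨ coef-⊕ p′ q′ i ⟨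
  coef (p′ ⊕ q′) i        ∎
  where open ≡-Reasoning

⊕-congˡ : ∀ p {q q′} → q ≋ q′ → p ⊕ q ≋ p ⊕ q′
⊕-congˡ p q≋q′ = ⊕-cong (≋-refl {p}) q≋q′

⊕-assoc : ∀ p q r → (p ⊕ q) ⊕ r ≋ p ⊕ (q ⊕ r)
⊕-assoc p q r = coefwise λ i → begin
  coef ((p ⊕ q) ⊕ r) i                ≡⟨ coef-⊕ (p ⊕ q) r i ⟩
  coef (p ⊕ q) i xor coef r i         ≡⟨ cong (_xor coef r i) (coef-⊕ p q i) ⟩
  (coef p i xor coef q i) xor coef r i ≡⟨ xor-assoc (coef p i) _ _ ⟩
  coef p i xor (coef q i xor coef r i) ≡⟨ cong (coef p i xor_) (coef-⊕ q r i) ⟨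
  coef p i xor coef (q ⊕ r) i         ≡⟨ coef-⊕ p (q ⊕ r) i ⟨
  coef (p ⊕ (q ⊕ r)) i                ∎
  where open ≡-Reasoning

⊕-comm : ∀ p q → p ⊕ q ≋ q ⊕ p
⊕-comm p q = coefwise λ i → begin
  coef (p ⊕ q) i        ≡⟨ coef-⊕ p q i ⟩
  coef p i xor coef q i ≡⟨ xor-comm (coef p i) _ ⟩
  coef q i xor coef p i ≡⟨ coef-⊕ q p i ⟨
  coef (q ⊕ p) i        ∎
  where open ≡-Reasoning

⊕-identityʳ : ∀ p → p ⊕ [] ≡ p
⊕-identityʳ []      = refl
⊕-identityʳ (a ∷ p) = refl

⊕-self : ∀ p → p ⊕ p ≋ []
⊕-self p = coefwise λ i → trans (coef-⊕ p p i) (xor-same (coef p i))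

⊕-commutativeMonoid : CommutativeMonoid 0ℓ 0ℓ
⊕-commutativeMonoid = record
  { isCommutativeMonoid = record
    { isMonoid = record
      { isSemigroup = record
        { isMagma = record { isEquivalence = Setoid.isEquivalence ≋-setoid ; ∙-cong = ⊕-cong }
        ; assoc = ⊕-assoc }
      ; identity = (λ _ → ≋-refl) , (λ p → ≋-reflexive (⊕-identityʳ p)) }
    ; comm = ⊕-comm } }

open import Algebra.Properties.CommutativeSemigroup
  (CommutativeMonoid.commutativeSemigroup ⊕-commutativeMonoid)
  using () renaming (interchange to ⊕-interchange; x∙yz≈y∙xz to ⊕-leftComm)

⊕-≋[] : ∀ p {z} → z ≋ [] → p ⊕ z ≋ p
⊕-≋[] p z≋[] = ≋-trans (⊕-congˡ p z≋[]) (≋-reflexive (⊕-identityʳ p))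

⊕≋[]⇒≋ : ∀ {p q} → p ⊕ q ≋ [] → p ≋ q
⊕≋[]⇒≋ {p} {q} p⊕q≋[] = begin
  p             ≈⟨ ⊕-≋[] p (⊕-self q) ⟨
  p ⊕ (q ⊕ q)   ≈⟨ ⊕-assoc p q q ⟨
  (p ⊕ q) ⊕ q   ≈⟨ ⊕-cong p⊕q≋[] ≋-refl ⟩
  q             ∎
  where open ≋-Reasoning

≋⇒⊕≋[] : ∀ {p q} → p ≋ q → p ⊕ q ≋ []
≋⇒⊕≋[] {q = q} p≋q = ≋-trans (⊕-cong p≋q ≋-refl) (⊕-self q)

infixr 25 _·_
_·_ : Bool → Poly → Poly
a · p = if a then p else []

·-cong : ∀ a {p q} → p ≋ q → a · p ≋ a · q
·-cong false _   = ≋-refl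
·-cong true  p≋q = p≋q

·-distrib-xor : ∀ a b p → (a xor b) · p ≋ a · p ⊕ b · p
·-distrib-xor false b    p = ≋-refl
·-distrib-xor true false p = ≋-sym (≋-reflexive (⊕-identityʳ p))
·-distrib-xor true true  p = ≋-sym (⊕-self p)

⊛-zeroʳ : ∀ p → p ⊛ [] ≋ []
⊛-zeroʳ []      = ≋-refl
⊛-zeroʳ (false ∷ p) = false∷≋[] (⊛-zeroʳ p)
⊛-zeroʳ (true  ∷ p) = false∷≋[] (⊛-zeroʳ p)

⊛-congˡ : ∀ p {q q′} → q ≋ q′ → p ⊛ q ≋ p ⊛ q′
⊛-congˡ []      q≋q′ = ≋-refl
⊛-congˡ (a ∷ p) q≋q′ = ⊕-cong (·-cong a q≋q′) (∷-cong refl (⊛-congˡ p q≋q′))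

⊛-identityˡ : ∀ p → one ⊛ p ≋ p
⊛-identityˡ p = ⊕-≋[] p (false∷≋[] ≋-refl)

·-⊛ : ∀ a p q → (a · p) ⊛ q ≋ a · (p ⊛ q)
·-⊛ false p q = ≋-refl
·-⊛ true  p q = ≋-refl

·one-⊛ : ∀ a p → (a · one) ⊛ p ≋ a · p
·one-⊛ false p = ≋-refl
·one-⊛ true  p = ⊛-identityˡ p

∷≋· : ∀ c {p} → p ≋ [] → c ∷ p ≋ c · one
∷≋· false p≋[] = false∷≋[] p≋[]
∷≋· true  p≋[] = ∷-cong refl p≋[]

⊛-distribʳ : ∀ p q r → (p ⊕ q) ⊛ r ≋ (p ⊛ r) ⊕ (q ⊛ r)
⊛-distribʳ []      q       r = ≋-refl
⊛-distribʳ (a ∷ p) []      r = ≋-sym (≋-reflexive (⊕-identityʳ _))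
⊛-distribʳ (a ∷ p) (b ∷ q) r = begin
  (a xor b) · r ⊕ (false ∷ (p ⊕ q) ⊛ r)
    ≈⟨ ⊕-cong (·-distrib-xor a b r) (∷-cong refl (⊛-distribʳ p q r)) ⟩
  (a · r ⊕ b · r) ⊕ (false ∷ (p ⊛ r) ⊕ (q ⊛ r))
    ≈⟨ ⊕-interchange (a · r) (b · r) (false ∷ p ⊛ r) (false ∷ q ⊛ r) ⟩
  (a · r ⊕ (false ∷ p ⊛ r)) ⊕ (b · r ⊕ (false ∷ q ⊛ r)) ∎
  where open ≋-Reasoning

⊛-assoc : ∀ p q r → (p ⊛ q) ⊛ r ≋ p ⊛ (q ⊛ r)
⊛-assoc []      q r = ≋-refl
⊛-assoc (a ∷ p) q r = begin
  (a · q ⊕ (false ∷ p ⊛ q)) ⊛ r         ≈⟨ ⊛-distribʳ (a · q) (false ∷ p ⊛ q) r ⟩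
  ((a · q) ⊛ r) ⊕ (false ∷ (p ⊛ q) ⊛ r)   ≈⟨ ⊕-cong (·-⊛ a q r) (∷-cong refl (⊛-assoc p q r)) ⟩
  a · (q ⊛ r) ⊕ (false ∷ p ⊛ (q ⊛ r))   ∎
  where open ≋-Reasoning

⊛-∷ʳ : ∀ p b q → p ⊛ (b ∷ q) ≋ b · p ⊕ (false ∷ p ⊛ q)
⊛-∷ʳ []      false q = ≋-sym (false∷≋[] ≋-refl)
⊛-∷ʳ []      true  q = ≋-sym (false∷≋[] ≋-refl)
⊛-∷ʳ (a ∷ p) b     q = ≋-trans (⊕-congˡ (a · (b ∷ q)) (∷-cong refl (⊛-∷ʳ p b q))) (swap a b)
  where
  swap : ∀ a b → a · (b ∷ q) ⊕ (false ∷ b · p ⊕ (false ∷ p ⊛ q))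
               ≋ b · (a ∷ p) ⊕ (false ∷ a · q ⊕ (false ∷ p ⊛ q))
  swap false false = ≋-refl
  swap false true  = ≋-refl
  swap true  false = ≋-refl
  swap true  true  = ∷-cong refl (⊕-leftComm q p (false ∷ p ⊛ q))

⊛-comm : ∀ p q → p ⊛ q ≋ q ⊛ p
⊛-comm []      q = ≋-sym (⊛-zeroʳ q)
⊛-comm (a ∷ p) q = ≋-trans (⊕-congˡ (a · q) (∷-cong refl (⊛-comm p q))) (≋-sym (⊛-∷ʳ q a p))

⊛-congʳ : ∀ {p p′} q → p ≋ p′ → p ⊛ q ≋ p′ ⊛ q
⊛-congʳ {p} {p′} q p≋p′ = ≋-trans (⊛-comm p q) (≋-trans (⊛-congˡ q p≋p′) (⊛-comm q p′))

⊛-cong : ∀ {p p′ q q′} → p ≋ p′ → q ≋ q′ → p ⊛ q ≋ p′ ⊛ q′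
⊛-cong {p′ = p′} {q = q} p≋p′ q≋q′ = ≋-trans (⊛-congʳ q p≋p′) (⊛-congˡ p′ q≋q′)

⊛-distribˡ : ∀ r p q → r ⊛ (p ⊕ q) ≋ (r ⊛ p) ⊕ (r ⊛ q)
⊛-distribˡ r p q = begin
  r ⊛ (p ⊕ q)       ≈⟨ ⊛-comm r (p ⊕ q) ⟩
  (p ⊕ q) ⊛ r       ≈⟨ ⊛-distribʳ p q r ⟩
  (p ⊛ r) ⊕ (q ⊛ r) ≈⟨ ⊕-cong (⊛-comm p r) (⊛-comm q r) ⟩
  (r ⊛ p) ⊕ (r ⊛ q) ∎
  where open ≋-Reasoning

⊛-zeroˡ : ∀ {z} q → z ≋ [] → z ⊛ q ≋ []
⊛-zeroˡ q z≋[] = ⊛-congʳ q z≋[]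

infix 30 T^_
T^_ : ℕ → Poly
T^ zero  = one
T^ suc n = false ∷ T^ n

T-⊛ : ∀ p → T ⊛ p ≋ false ∷ p
T-⊛ p = ∷-cong refl (⊛-identityˡ p)

record Deg< (k : ℕ) (p : Poly) : Set where
  constructor vanishing
  field vanishes : ∀ i → k ≤ i → coef p i ≡ false
open Deg<

Deg<-resp-≋ : ∀ {k p q} → p ≋ q → Deg< k p → Deg< k q
Deg<-resp-≋ p≋q d = vanishing λ i k≤i → trans (sym (coef-≡ p≋q i)) (vanishes d i k≤i)

Deg<-⊕ : ∀ {k p q} → Deg< k p → Deg< k q → Deg< k (p ⊕ q)
Deg<-⊕ {p = p} {q} dp dq = vanishing λ i k≤i →
  trans (coef-⊕ p q i) (cong₂ _xor_ (vanishes dp i k≤i) (vanishes dq i k≤i))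

Deg<-mono : ∀ {j k p} → j ≤ k → Deg< j p → Deg< k p
Deg<-mono j≤k d = vanishing λ i k≤i → vanishes d i (ℕ.≤-trans j≤k k≤i)

Deg<-· : ∀ {k} a {p} → Deg< k p → Deg< k (a · p)
Deg<-· false d = vanishing λ _ _ → refl
Deg<-· true  d = d

Deg<-tail : ∀ {k a p} → Deg< (suc k) (a ∷ p) → Deg< k p
Deg<-tail d = vanishing λ i k≤i → vanishes d (suc i) (s≤s k≤i)

Deg<-∷ : ∀ {k a p} → Deg< k p → Deg< (suc k) (a ∷ p)
Deg<-∷ d = vanishing λ { (suc i) (s≤s k≤i) → vanishes d i k≤i }

Deg<0⇒≋[] : ∀ {p} → Deg< 0 p → p ≋ []
Deg<0⇒≋[] d = coefwise λ i → vanishes d i z≤n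

≋[]⇒Deg< : ∀ {k p} → p ≋ [] → Deg< k p
≋[]⇒Deg< p≋[] = vanishing λ i _ → coef-≡ p≋[] i

Deg<1-tail : ∀ {a p} → Deg< 1 (a ∷ p) → p ≋ []
Deg<1-tail d = Deg<0⇒≋[] (Deg<-tail d)

Deg<-⊛ : ∀ a b {p q} → Deg< (suc a) p → Deg< (suc b) q → Deg< (suc (a + b)) (p ⊛ q)
Deg<-⊛ a b {[]}    dp dq = vanishing λ _ _ → refl
Deg<-⊛ a b {c ∷ p} {q} dp dq =
  Deg<-⊕ (Deg<-· c (Deg<-mono (s≤s (ℕ.m≤n+m b a)) dq)) (Deg<-∷ (tail-product a dp))
  where
  tail-product : ∀ a → Deg< (suc a) (c ∷ p) → Deg< (a + b) (p ⊛ q)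
  tail-product zero    dp = ≋[]⇒Deg< (⊛-zeroˡ q (Deg<1-tail dp))
  tail-product (suc a) dp = Deg<-⊛ a b (Deg<-tail dp) dq

Deg<-T^ : ∀ n → Deg< (suc n) (T^ n)
Deg<-T^ zero    = Deg<-∷ (vanishing λ _ _ → refl)
Deg<-T^ (suc n) = Deg<-∷ (Deg<-T^ n)

Deg<-T+1 : Deg< 2 T+1
Deg<-T+1 = Deg<-∷ (Deg<-∷ (vanishing λ _ _ → refl))

data Monic : ℕ → Poly → Set where
  one-monic : Monic 0 one
  ∷-monic   : ∀ {n} a {p} → Monic n p → Monic (suc n) (a ∷ p)

Monic⇒Deg< : ∀ {n p} → Monic n p → Deg< (suc n) p
Monic⇒Deg< one-monic     = Deg<-∷ (vanishing λ _ _ → refl)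
Monic⇒Deg< (∷-monic a m) = Deg<-∷ (Monic⇒Deg< m)

Monic-length : ∀ {n p} → Monic n p → length p ≡ suc n
Monic-length one-monic     = refl
Monic-length (∷-monic a m) = cong suc (Monic-length m)

Monic-deg : ∀ {n p} → Monic n p → deg p ≡ n
Monic-deg m = cong (_∸ 1) (Monic-length m)

Monic-deg-unique : ∀ {m n p} → Monic m p → Monic n p → m ≡ n
Monic-deg-unique mp np = trans (sym (Monic-deg mp)) (Monic-deg np)

Monic≉[] : ∀ {n p} → Monic n p → ¬ p ≋ []
Monic≉[] one-monic     p≋[] with () ← proj₁ (∷≋[] p≋[])
Monic≉[] (∷-monic a m) p≋[] = Monic≉[] m (proj₂ (∷≋[] p≋[]))

Monic-Deg< : ∀ {n k p} → Monic n p → Deg< k p → n < k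
Monic-Deg< {k = zero}  m d = ⊥-elim (Monic≉[] m (Deg<0⇒≋[] d))
Monic-Deg< {k = suc k} one-monic     d = s≤s z≤n
Monic-Deg< {k = suc k} (∷-monic a m) d = s≤s (Monic-Deg< m (Deg<-tail d))

Monic-≋⇒≡ : ∀ {m n p q} → Monic m p → Monic n q → p ≋ q → p ≡ q
Monic-≋⇒≡ one-monic     one-monic     _   = refl
Monic-≋⇒≡ one-monic     (∷-monic a m) p≋q = ⊥-elim (Monic≉[] m (≋-sym (proj₂ (∷-injective p≋q))))
Monic-≋⇒≡ (∷-monic a m) one-monic     p≋q = ⊥-elim (Monic≉[] m (proj₂ (∷-injective p≋q)))
Monic-≋⇒≡ (∷-monic a m) (∷-monic b n) p≋q =
  cong₂ _∷_ (proj₁ (∷-injective p≋q)) (Monic-≋⇒≡ m n (proj₂ (∷-injective p≋q)))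

Monic-shorter-⊕ : ∀ {k q x} → length q ≤ k → Monic k x → Monic k (q ⊕ x)
Monic-shorter-⊕ {q = []}    _         m             = m
Monic-shorter-⊕ {q = b ∷ q} (s≤s q≤k) (∷-monic a m) = ∷-monic (b xor a) (Monic-shorter-⊕ q≤k m)

Monic-⊛ : ∀ {a b p q} → Monic a p → Monic b q → Monic (a + b) (p ⊛ q)
Monic-⊛ one-monic one-monic = one-monic
Monic-⊛ one-monic (∷-monic c {q} m)
  rewrite xor-identityʳ c | ⊕-identityʳ q = ∷-monic c m
Monic-⊛ {suc a} {b} {q = q} (∷-monic c mp) mq =
  Monic-shorter-⊕ (·-length c) (∷-monic false (Monic-⊛ mp mq))
  where
  ·-length : ∀ c → length (c · q) ≤ suc (a + b)
  ·-length false = z≤n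
  ·-length true  = subst (_≤ suc (a + b)) (sym (Monic-length mq)) (s≤s (ℕ.m≤n+m b a))

norm-≋ : ∀ p → norm p ≋ p
norm-≋ []      = ≋-refl
norm-≋ (a ∷ p) with norm p | norm-≋ p
... | []    | p≋[] = head a
  where
  head : ∀ a → (if a then one else []) ≋ a ∷ p
  head false = ≋-sym (false∷≋[] (≋-sym p≋[]))
  head true  = ∷-cong refl p≋[]
... | _ ∷ _ | q≋p = ∷-cong refl q≋p

norm-≡⇒≋ : ∀ {p q} → norm p ≡ norm q → p ≋ q
norm-≡⇒≋ {p} {q} eq = ≋-trans (≋-sym (norm-≋ p)) (≋-trans (≋-reflexive eq) (norm-≋ q))

norm-zero-or-monic : ∀ p → norm p ≡ [] ⊎ ∃[ k ] Monic k (norm p)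
norm-zero-or-monic []      = inj₁ refl
norm-zero-or-monic (a ∷ p) with norm p | norm-zero-or-monic p
... | []    | _             = constant a
  where
  constant : ∀ a → (if a then one else []) ≡ [] ⊎ ∃[ k ] Monic k (if a then one else [])
  constant false = inj₁ refl
  constant true  = inj₂ (0 , one-monic)
... | _ ∷ _ | inj₂ (k , m) = inj₂ (suc k , ∷-monic a m)

≋[]-or-monic : ∀ p → p ≋ [] ⊎ ∃[ k ] Monic k (norm p)
≋[]-or-monic p with norm-zero-or-monic p
... | inj₁ norm≡[] = inj₁ (≋-trans (≋-sym (norm-≋ p)) (≋-reflexive norm≡[]))
... | inj₂ monic   = inj₂ monic

Deg<-exact : ∀ {n p} → Deg< (suc n) p → ¬ Deg< n p → Monic n (norm p)
Deg<-exact {n} {p} d<n+1 d≮n with ≋[]-or-monic p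
... | inj₁ p≋[]     = ⊥-elim (d≮n (≋[]⇒Deg< p≋[]))
... | inj₂ (k , mk) with ℕ.m≤n⇒m<n∨m≡n (ℕ.≤-pred (Monic-Deg< mk (Deg<-resp-≋ (≋-sym (norm-≋ p)) d<n+1)))
...   | inj₂ refl = mk
...   | inj₁ k<n  = ⊥-elim (d≮n (Deg<-resp-≋ (norm-≋ p) (Deg<-mono k<n (Monic⇒Deg< mk))))

-- The substitution f ↦ Tⁿ f((T+1)/T)

-- For deg p ≤ n this is Σ pᵢ Tⁿ⁻ⁱ (T+1)ⁱ; for longer p the `pred` makes the value junk.
Ψ : ℕ → Poly → Poly
Ψ n []      = []
Ψ n (a ∷ p) = a · T^ n ⊕ (T+1 ⊛ Ψ (pred n) p)

Ψ-zero : ∀ n {p} → p ≋ [] → Ψ n p ≋ []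
Ψ-zero n {[]}    _    = ≋-refl
Ψ-zero n {a ∷ p} p≋[] with ∷≋[] p≋[]
... | refl , tail≋[] = ≋-trans (⊛-congˡ T+1 (Ψ-zero (pred n) tail≋[])) (⊛-zeroʳ T+1)

Ψ-⊕ : ∀ n p q → Ψ n (p ⊕ q) ≋ Ψ n p ⊕ Ψ n q
Ψ-⊕ n []      q       = ≋-refl
Ψ-⊕ n (a ∷ p) []      = ≋-sym (≋-reflexive (⊕-identityʳ _))
Ψ-⊕ n (a ∷ p) (b ∷ q) = begin
  (a xor b) · T^ n ⊕ (T+1 ⊛ Ψ m (p ⊕ q))
    ≈⟨ ⊕-cong (·-distrib-xor a b (T^ n)) (⊛-congˡ T+1 (Ψ-⊕ m p q)) ⟩
  (a · T^ n ⊕ b · T^ n) ⊕ (T+1 ⊛ (Ψ m p ⊕ Ψ m q))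
    ≈⟨ ⊕-congˡ (a · T^ n ⊕ b · T^ n) (⊛-distribˡ T+1 (Ψ m p) (Ψ m q)) ⟩
  (a · T^ n ⊕ b · T^ n) ⊕ ((T+1 ⊛ Ψ m p) ⊕ (T+1 ⊛ Ψ m q))
    ≈⟨ ⊕-interchange (a · T^ n) (b · T^ n) (T+1 ⊛ Ψ m p) (T+1 ⊛ Ψ m q) ⟩
  (a · T^ n ⊕ (T+1 ⊛ Ψ m p)) ⊕ (b · T^ n ⊕ (T+1 ⊛ Ψ m q)) ∎
  where
  open ≋-Reasoning
  m = pred n

Ψ-cong : ∀ n {p q} → p ≋ q → Ψ n p ≋ Ψ n q
Ψ-cong n {p} {q} p≋q =
  ⊕≋[]⇒≋ (≋-trans (≋-sym (Ψ-⊕ n p q)) (Ψ-zero n (≋⇒⊕≋[] p≋q)))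

Ψ-· : ∀ n a p → Ψ n (a · p) ≋ a · Ψ n p
Ψ-· n false p = ≋-refl
Ψ-· n true  p = ≋-refl

Ψ-const : ∀ n c → Ψ n (c · one) ≋ c · T^ n
Ψ-const n false = ≋-refl
Ψ-const n true  = ⊕-≋[] (T^ n) (⊛-zeroʳ T+1)

Ψ-∷[] : ∀ n c {p} → p ≋ [] → Ψ n (c ∷ p) ≋ c · T^ n
Ψ-∷[] n c p≋[] = ≋-trans (Ψ-cong n (∷≋· c p≋[])) (Ψ-const n c)

Deg<-Ψ : ∀ n {p} → Deg< (suc n) p → Deg< (suc n) (Ψ n p)
Deg<-Ψ n       {[]}    _ = vanishing λ _ _ → refl
Deg<-Ψ zero    {c ∷ p} d = Deg<-resp-≋ (≋-sym (Ψ-∷[] 0 c (Deg<1-tail d))) (Deg<-· c (Deg<-T^ 0))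
Deg<-Ψ (suc n) {c ∷ p} d =
  Deg<-⊕ (Deg<-· c (Deg<-T^ (suc n))) (Deg<-⊛ 1 n Deg<-T+1 (Deg<-Ψ n (Deg<-tail d)))

Ψ-suc : ∀ n {p} → Deg< (suc n) p → Ψ (suc n) p ≋ false ∷ Ψ n p
Ψ-suc n       {[]}    _ = ≋-sym (false∷≋[] ≋-refl)
Ψ-suc zero    {c ∷ p} d = begin
  Ψ 1 (c ∷ p)          ≈⟨ Ψ-∷[] 1 c p≋[] ⟩
  c · T^ 1             ≈⟨ shift c ⟩
  false ∷ c · T^ 0     ≈⟨ ∷-cong refl (Ψ-∷[] 0 c p≋[]) ⟨
  false ∷ Ψ 0 (c ∷ p)  ∎
  where
  open ≋-Reasoning
  p≋[] = Deg<1-tail d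
  shift : ∀ c → c · T^ 1 ≋ false ∷ c · T^ 0
  shift false = ≋-sym (false∷≋[] ≋-refl)
  shift true  = ≋-refl
Ψ-suc (suc n) {c ∷ p} d = begin
  c · T^ (suc (suc n)) ⊕ (T+1 ⊛ Ψ (suc n) p)   ≈⟨ ⊕-congˡ (c · T^ (suc (suc n))) (⊛-congˡ T+1 (Ψ-suc n (Deg<-tail d))) ⟩
  c · T^ (suc (suc n)) ⊕ (T+1 ⊛ (false ∷ X))   ≈⟨ ⊕-congˡ (c · T^ (suc (suc n))) (⊛-∷ʳ T+1 false X) ⟩
  c · (false ∷ T^ suc n) ⊕ (false ∷ T+1 ⊛ X)   ≈⟨ shift c ⟩
  false ∷ (c · T^ suc n ⊕ (T+1 ⊛ X))           ∎
  where
  open ≋-Reasoning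
  X = Ψ n p
  shift : ∀ c → c · (false ∷ T^ suc n) ⊕ (false ∷ T+1 ⊛ X) ≋ false ∷ (c · T^ suc n ⊕ (T+1 ⊛ X))
  shift false = ≋-refl
  shift true  = ≋-refl

Ψ-shift : ∀ k n {p} → Deg< (suc n) p → Ψ (k + n) p ≋ T^ k ⊛ Ψ n p
Ψ-shift zero    n d = ≋-sym (⊛-identityˡ _)
Ψ-shift (suc k) n d =
  ≋-trans (Ψ-suc (k + n) (Deg<-mono (s≤s (ℕ.m≤n+m n k)) d)) (∷-cong refl (Ψ-shift k n d))

Ψ-⊛ : ∀ a b {g h} → Deg< (suc a) g → Deg< (suc b) h → Ψ (a + b) (g ⊛ h) ≋ Ψ a g ⊛ Ψ b h
Ψ-⊛ a       b {[]}        _  _  = ≋-refl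
Ψ-⊛ zero    b {c ∷ g} {h} dg dh = begin
  Ψ b ((c ∷ g) ⊛ h)    ≈⟨ Ψ-cong b (⊛-congʳ h (∷≋· c (Deg<1-tail dg))) ⟩
  Ψ b ((c · one) ⊛ h)  ≈⟨ Ψ-cong b (·one-⊛ c h) ⟩
  Ψ b (c · h)          ≈⟨ Ψ-· b c h ⟩
  c · Ψ b h            ≈⟨ ·one-⊛ c (Ψ b h) ⟨
  (c · one) ⊛ Ψ b h    ≈⟨ ⊛-congʳ (Ψ b h) (Ψ-∷[] 0 c (Deg<1-tail dg)) ⟨
  Ψ 0 (c ∷ g) ⊛ Ψ b h  ∎
  where open ≋-Reasoning
Ψ-⊛ (suc a) b {c ∷ g} {h} dg dh = begin
  Ψ (suc a + b) (c · h ⊕ (false ∷ g ⊛ h))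
    ≈⟨ Ψ-⊕ (suc a + b) (c · h) (false ∷ g ⊛ h) ⟩
  Ψ (suc a + b) (c · h) ⊕ (T+1 ⊛ Ψ (a + b) (g ⊛ h))
    ≈⟨ ⊕-cong (≋-trans (Ψ-· (suc a + b) c h) (·-cong c (Ψ-shift (suc a) b dh)))
              (⊛-congˡ T+1 (Ψ-⊛ a b (Deg<-tail dg) dh)) ⟩
  c · (T^ suc a ⊛ Ψ b h) ⊕ (T+1 ⊛ (Ψ a g ⊛ Ψ b h))
    ≈⟨ ⊕-cong (·-⊛ c (T^ suc a) (Ψ b h)) (⊛-assoc T+1 (Ψ a g) (Ψ b h)) ⟨
  ((c · T^ suc a) ⊛ Ψ b h) ⊕ ((T+1 ⊛ Ψ a g) ⊛ Ψ b h)
    ≈⟨ ⊛-distribʳ (c · T^ suc a) (T+1 ⊛ Ψ a g) (Ψ b h) ⟨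
  Ψ (suc a) (c ∷ g) ⊛ Ψ b h ∎
  where open ≋-Reasoning

infix 30 T+1^_
T+1^_ : ℕ → Poly
T+1^ zero  = one
T+1^ suc n = T+1 ⊛ T+1^ n

Deg<-T+1^ : ∀ n → Deg< (suc n) (T+1^ n)
Deg<-T+1^ zero    = Deg<-T^ 0
Deg<-T+1^ (suc n) = Deg<-⊛ 1 n Deg<-T+1 (Deg<-T+1^ n)

Ψ-T^ : ∀ n → Ψ n (T^ n) ≋ T+1^ n
Ψ-T^ zero    = Ψ-const 0 true
Ψ-T^ (suc n) = ⊛-congˡ T+1 (Ψ-T^ n)

Ψ-T : Ψ 1 T ≋ T+1
Ψ-T = norm-≡⇒≋ refl

Ψ-T+1 : Ψ 1 T+1 ≋ one
Ψ-T+1 = norm-≡⇒≋ refl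

Ψ-T+1^ : ∀ n → Ψ n (T+1^ n) ≋ one
Ψ-T+1^ zero    = Ψ-const 0 true
Ψ-T+1^ (suc n) = begin
  Ψ (1 + n) (T+1 ⊛ T+1^ n)      ≈⟨ Ψ-⊛ 1 n Deg<-T+1 (Deg<-T+1^ n) ⟩
  Ψ 1 T+1 ⊛ Ψ n (T+1^ n)        ≈⟨ ⊛-cong Ψ-T+1 (Ψ-T+1^ n) ⟩
  one ⊛ one                     ≈⟨ ⊛-identityˡ one ⟩
  one                           ∎
  where open ≋-Reasoning

Ψ³ : ∀ n {p} → Deg< (suc n) p → Ψ n (Ψ n (Ψ n p)) ≋ p
Ψ³ n       {[]}    _ = ≋-refl
Ψ³ zero    {c ∷ p} d = begin
  Ψ 0 (Ψ 0 (Ψ 0 (c ∷ p)))   ≈⟨ Ψ-cong 0 (Ψ-cong 0 (Ψ-∷[] 0 c p≋[])) ⟩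
  Ψ 0 (Ψ 0 (c · one))       ≈⟨ Ψ-cong 0 (Ψ-const 0 c) ⟩
  Ψ 0 (c · one)             ≈⟨ Ψ-const 0 c ⟩
  c · one                   ≈⟨ ∷≋· c p≋[] ⟨
  c ∷ p                     ∎
  where
  open ≋-Reasoning
  p≋[] = Deg<1-tail d
Ψ³ (suc n) {c ∷ p} d = begin
  Ψ N (Ψ N (Ψ N (c ∷ p)))                  ≈⟨ Ψ-cong N (Ψ-⊕ N (c · T^ N) (T+1 ⊛ X)) ⟩
  Ψ N (Ψ N (c · T^ N) ⊕ Ψ (1 + n) (T+1 ⊛ X))
    ≈⟨ Ψ-cong N (⊕-cong (≋-trans (Ψ-· N c (T^ N)) (·-cong c (Ψ-T^ N))) (Ψ-⊛ 1 n Deg<-T+1 dX)) ⟩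
  Ψ N (c · T+1^ N ⊕ (Ψ 1 T+1 ⊛ Ψ n X))
    ≈⟨ Ψ-cong N (⊕-congˡ (c · T+1^ N) (≋-trans (⊛-congʳ (Ψ n X) Ψ-T+1) (⊛-identityˡ (Ψ n X)))) ⟩
  Ψ N (c · T+1^ N ⊕ Ψ n X)                 ≈⟨ Ψ-⊕ N (c · T+1^ N) (Ψ n X) ⟩
  Ψ N (c · T+1^ N) ⊕ Ψ (1 + n) (Ψ n X)
    ≈⟨ ⊕-cong (≋-trans (Ψ-· N c (T+1^ N)) (·-cong c (Ψ-T+1^ N))) (Ψ-suc n (Deg<-Ψ n dX)) ⟩
  c · one ⊕ (false ∷ Ψ n (Ψ n X))          ≈⟨ ⊕-congˡ (c · one) (∷-cong refl (Ψ³ n dp)) ⟩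
  c · one ⊕ (false ∷ p)                    ≈⟨ constant⊕ c ⟩
  c ∷ p                                    ∎
  where
  open ≋-Reasoning
  N = suc n
  dp = Deg<-tail d
  X = Ψ n p
  dX = Deg<-Ψ n dp
  constant⊕ : ∀ c → c · one ⊕ (false ∷ p) ≋ c ∷ p
  constant⊕ false = ≋-refl
  constant⊕ true  = ≋-refl

-- Residues modulo T³ + T + 1

-- (a , b , c) stands for a + bα + cα² with α³ = α + 1; mulα is multiplication by α.
F₈ : Set
F₈ = Bool × Bool × Bool

0# 1# α : F₈
0# = false , false , false
1# = true  , false , false
α  = false , true  , false

⟦_⟧ : Bool → F₈
⟦ a ⟧ = a , false , false

infixl 6 _+₈_
_+₈_ : F₈ → F₈ → F₈
(a , b , c) +₈ (a′ , b′ , c′) = a xor a′ , b xor b′ , c xor c′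

infixr 7 _·₈_
_·₈_ : Bool → F₈ → F₈
a ·₈ x = if a then x else 0#

mulα : F₈ → F₈
mulα (a , b , c) = c , a xor c , b

infixl 7 _*₈_
_*₈_ : F₈ → F₈ → F₈
(a , b , c) *₈ y = a ·₈ y +₈ mulα (b ·₈ y +₈ mulα (c ·₈ y))

infixr 8 α^_
α^_ : ℕ → F₈
α^ zero  = 1#
α^ suc n = α *₈ α^ n

_≟₈_ : DecidableEquality F₈
_≟₈_ = ≡-dec _≟ᵇ_ (≡-dec _≟ᵇ_ _≟ᵇ_)

+₈-identityʳ : ∀ x → x +₈ 0# ≡ x
+₈-identityʳ (a , b , c) = cong₂ _,_ (xor-identityʳ a) (cong₂ _,_ (xor-identityʳ b) (xor-identityʳ c))

∀-Bool? : {P : Bool → Set} → (∀ b → Dec (P b)) → Dec (∀ b → P b)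
∀-Bool? P? = map′ (λ (f , t) → λ { false → f ; true → t }) (λ h → h false , h true) (P? false ×-dec P? true)

∀-F₈? : {P : F₈ → Set} → (∀ x → Dec (P x)) → Dec (∀ x → P x)
∀-F₈? P? = map′ (λ h (a , b , c) → h a b c) (λ h a b c → h (a , b , c))
  (∀-Bool? λ a → ∀-Bool? λ b → ∀-Bool? λ c → P? (a , b , c))

ev : Poly → F₈
ev = foldr (λ a x → ⟦ a ⟧ +₈ α *₈ x) 0#

toPoly : F₈ → Poly
toPoly (a , b , c) = norm (a ∷ b ∷ c ∷ [])

remStep-toPoly : ∀ a x → toPoly (⟦ a ⟧ +₈ α *₈ x) ≡ remStep mPoly a (toPoly x)
remStep-toPoly = from-yes (∀-Bool? λ a → ∀-F₈? λ x →
  ≡-dec-List _≟ᵇ_ (toPoly (⟦ a ⟧ +₈ α *₈ x)) (remStep mPoly a (toPoly x)))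

toPoly-ev : ∀ f → toPoly (ev f) ≡ f rem mPoly
toPoly-ev = foldr-fusion toPoly 0# remStep-toPoly

ev-⊕ : ∀ p q → ev (p ⊕ q) ≡ ev p +₈ ev q
ev-⊕ []      q       = refl
ev-⊕ (a ∷ p) []      = sym (+₈-identityʳ _)
ev-⊕ (a ∷ p) (b ∷ q) = trans (cong (λ z → ⟦ a xor b ⟧ +₈ α *₈ z) (ev-⊕ p q)) (horner-additive a b (ev p) (ev q))
  where
  horner-additive : ∀ a b x y → ⟦ a xor b ⟧ +₈ α *₈ (x +₈ y) ≡ (⟦ a ⟧ +₈ α *₈ x) +₈ (⟦ b ⟧ +₈ α *₈ y)
  horner-additive = from-yes (∀-Bool? λ a → ∀-Bool? λ b → ∀-F₈? λ x → ∀-F₈? λ y →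
    (⟦ a xor b ⟧ +₈ α *₈ (x +₈ y)) ≟₈ ((⟦ a ⟧ +₈ α *₈ x) +₈ (⟦ b ⟧ +₈ α *₈ y)))

ev-· : ∀ a p → ev (a · p) ≡ a ·₈ ev p
ev-· false p = refl
ev-· true  p = refl

ev-⊛ : ∀ p q → ev (p ⊛ q) ≡ ev p *₈ ev q
ev-⊛ []      q = sym (*₈-zeroˡ (ev q))
  where
  *₈-zeroˡ : ∀ x → 0# *₈ x ≡ 0#
  *₈-zeroˡ = from-yes (∀-F₈? λ x → (0# *₈ x) ≟₈ 0#)
ev-⊛ (a ∷ p) q = begin
  ev (a · q ⊕ (false ∷ p ⊛ q))              ≡⟨ ev-⊕ (a · q) (false ∷ p ⊛ q) ⟩
  ev (a · q) +₈ (0# +₈ α *₈ ev (p ⊛ q))      ≡⟨ cong₂ (λ u v → u +₈ (0# +₈ α *₈ v)) (ev-· a q) (ev-⊛ p q) ⟩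
  a ·₈ ev q +₈ (0# +₈ α *₈ (ev p *₈ ev q))   ≡⟨ horner-multiplicative a (ev p) (ev q) ⟩
  (⟦ a ⟧ +₈ α *₈ ev p) *₈ ev q               ∎
  where
  open ≡-Reasoning
  horner-multiplicative : ∀ a x y → a ·₈ y +₈ (0# +₈ α *₈ (x *₈ y)) ≡ (⟦ a ⟧ +₈ α *₈ x) *₈ y
  horner-multiplicative = from-yes (∀-Bool? λ a → ∀-F₈? λ x → ∀-F₈? λ y →
    (a ·₈ y +₈ (0# +₈ α *₈ (x *₈ y))) ≟₈ ((⟦ a ⟧ +₈ α *₈ x) *₈ y))

ev-zero : ∀ {p} → p ≋ [] → ev p ≡ 0#
ev-zero {[]}    _    = refl
ev-zero {a ∷ p} p≋[] with ∷≋[] p≋[]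
... | refl , tail≋[] rewrite ev-zero tail≋[] = refl

ev-cong : ∀ {p q} → p ≋ q → ev p ≡ ev q
ev-cong {p} {q} p≋q = sum-zero (ev p) (ev q) (trans (sym (ev-⊕ p q)) (ev-zero (≋⇒⊕≋[] p≋q)))
  where
  sum-zero : ∀ x y → x +₈ y ≡ 0# → x ≡ y
  sum-zero = from-yes (∀-F₈? λ x → ∀-F₈? λ y → ((x +₈ y) ≟₈ 0#) →-dec (x ≟₈ y))

ev-T^ : ∀ n → ev (T^ n) ≡ α^ n
ev-T^ zero    = refl
ev-T^ (suc n) = cong (α *₈_) (ev-T^ n)

ev-Ψ : ∀ n {p} → Deg< (suc n) p → ev (Ψ n p) ≡ α^ n *₈ (ev p *₈ ev p)
ev-Ψ n       {[]}    _ = sym (*₈-zeroʳ (α^ n))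
  where
  *₈-zeroʳ : ∀ x → x *₈ 0# ≡ 0#
  *₈-zeroʳ = from-yes (∀-F₈? λ x → (x *₈ 0#) ≟₈ 0#)
ev-Ψ zero    {c ∷ p} d = begin
  ev (Ψ 0 (c ∷ p))             ≡⟨ ev-cong (Ψ-∷[] 0 c p≋[]) ⟩
  ev (c · one)                 ≡⟨ constant c ⟩
  1# *₈ (ev (c · one) *₈ ev (c · one)) ≡⟨ cong (λ z → 1# *₈ (z *₈ z)) (ev-cong (∷≋· c p≋[])) ⟨
  1# *₈ (ev (c ∷ p) *₈ ev (c ∷ p)) ∎
  where
  open ≡-Reasoning
  p≋[] = Deg<1-tail d
  constant : ∀ c → ev (c · one) ≡ 1# *₈ (ev (c · one) *₈ ev (c · one))
  constant false = refl
  constant true  = refl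
ev-Ψ (suc n) {c ∷ p} d = begin
  ev (c · T^ suc n ⊕ (T+1 ⊛ Ψ n p))
    ≡⟨ ev-⊕ (c · T^ suc n) (T+1 ⊛ Ψ n p) ⟩
  ev (c · T^ suc n) +₈ ev (T+1 ⊛ Ψ n p)
    ≡⟨ cong₂ _+₈_ (trans (ev-· c (T^ suc n)) (cong (c ·₈_) (ev-T^ (suc n)))) (ev-⊛ T+1 (Ψ n p)) ⟩
  c ·₈ α^ suc n +₈ ev T+1 *₈ ev (Ψ n p)
    ≡⟨ cong (λ z → c ·₈ α^ suc n +₈ ev T+1 *₈ z) (ev-Ψ n (Deg<-tail d)) ⟩
  c ·₈ (α *₈ α^ n) +₈ ev T+1 *₈ (α^ n *₈ (ev p *₈ ev p))
    ≡⟨ substitution-step c (α^ n) (ev p) ⟩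
  (α *₈ α^ n) *₈ (ev (c ∷ p) *₈ ev (c ∷ p)) ∎
  where
  open ≡-Reasoning
  -- α³ = α + 1 and squaring is additive, so α y (c + α x)² = c α y + (α + 1) y x².
  substitution-step : ∀ c y x →
    c ·₈ (α *₈ y) +₈ ev T+1 *₈ (y *₈ (x *₈ x)) ≡ (α *₈ y) *₈ ((⟦ c ⟧ +₈ α *₈ x) *₈ (⟦ c ⟧ +₈ α *₈ x))
  substitution-step = from-yes (∀-Bool? λ c → ∀-F₈? λ y → ∀-F₈? λ x →
    (c ·₈ (α *₈ y) +₈ ev T+1 *₈ (y *₈ (x *₈ x))) ≟₈ ((α *₈ y) *₈ ((⟦ c ⟧ +₈ α *₈ x) *₈ (⟦ c ⟧ +₈ α *₈ x))))

α^[q*7]≡1 : ∀ q → α^ (q * 7) ≡ 1#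
α^[q*7]≡1 zero = refl
α^[q*7]≡1 (suc q) rewrite α^[q*7]≡1 q = refl

α^-≡1-mod-7 : ∀ N → N % 7 ≡ 1 → α^ N ≡ α
α^-≡1-mod-7 N N%7≡1 = begin
  α^ N                   ≡⟨ cong α^_ (trans (m≡m%n+[m/n]*n N 7) (cong (_+ (N / 7) * 7) N%7≡1)) ⟩
  α^ (1 + (N / 7) * 7)   ≡⟨ cong (α *₈_) (α^[q*7]≡1 (N / 7)) ⟩
  α                      ∎
  where open ≡-Reasoning

residue-zero⇔≡ : ∀ x y → IsTrue (norm (toPoly (x +₈ y)) == []) ⇔ x ≡ y
residue-zero⇔≡ x y = mk⇔ (zero⇒≡ x y) (≡⇒zero x y)
  where
  zero⇒≡ : ∀ x y → IsTrue (norm (toPoly (x +₈ y)) == []) → x ≡ y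
  zero⇒≡ = from-yes (∀-F₈? λ x → ∀-F₈? λ y → T? (norm (toPoly (x +₈ y)) == []) →-dec (x ≟₈ y))
  ≡⇒zero : ∀ x y → x ≡ y → IsTrue (norm (toPoly (x +₈ y)) == [])
  ≡⇒zero = from-yes (∀-F₈? λ x → ∀-F₈? λ y → (x ≟₈ y) →-dec T? (norm (toPoly (x +₈ y)) == []))

congᵇ-mPoly⇔ev≡ : ∀ f c → IsTrue (congᵇ f c mPoly) ⇔ ev f ≡ ev c
congᵇ-mPoly⇔ev≡ f c = subst (λ r → IsTrue (norm r == []) ⇔ ev f ≡ ev c) residue (residue-zero⇔≡ (ev f) (ev c))
  where
  residue : toPoly (ev f +₈ ev c) ≡ (f ⊕ c) rem mPoly
  residue = trans (cong toPoly (sym (ev-⊕ f c))) (toPoly-ev (f ⊕ c))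

countᵇ-filter : ∀ {A : Set} (P : A → Bool) xs → countᵇ P xs ≡ length (filter (λ x → T? (P x)) xs)
countᵇ-filter P []       = refl
countᵇ-filter P (x ∷ xs) with P x
... | true  = cong suc (countᵇ-filter P xs)
... | false = countᵇ-filter P xs

∈-─ : ∀ {A : Set} {x y : A} {ys} → y ∈ ys → y ≢ x → (x∈ys : x ∈ ys) → y ∈ (ys ─ x∈ys)
∈-─ (here refl) y≢x (here refl) = ⊥-elim (y≢x refl)
∈-─ (here refl) _   (there _)   = here refl
∈-─ (there y∈)  _   (here refl) = y∈
∈-─ (there y∈)  y≢x (there x∈)  = there (∈-─ y∈ y≢x x∈)

length-≤-injection : ∀ {A B : Set} (f : A → B) {xs ys} → Unique xs →
  (∀ {x} → x ∈ xs → f x ∈ ys) → (∀ {x y} → x ∈ xs → y ∈ xs → f x ≡ f y → x ≡ y) →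
  length xs ≤ length ys
length-≤-injection f []               _    _   = z≤n
length-≤-injection f {x ∷ xs} {ys} (x≢xs ∷ unique) maps inj =
  ℕ.≤-trans (s≤s (length-≤-injection f unique maps′ inj′)) (ℕ.≤-reflexive (sym (length-removeAt′ ys (index fx∈ys))))
  where
  fx∈ys : f x ∈ ys
  fx∈ys = maps (here refl)
  maps′ : ∀ {y} → y ∈ xs → f y ∈ (ys ─ fx∈ys)
  maps′ y∈xs = ∈-─ (maps (there y∈xs))
    (λ fy≡fx → All.lookup x≢xs y∈xs (inj (here refl) (there y∈xs) (sym fy≡fx))) fx∈ys
  inj′ : ∀ {y z} → y ∈ xs → z ∈ xs → f y ≡ f z → y ≡ z
  inj′ y∈xs z∈xs = inj (there y∈xs) (there z∈xs)

countᵇ-≤ : ∀ {A : Set} (P Q : A → Bool) (f : A → A) {xs} → Unique xs →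
  (∀ {x} → x ∈ xs → IsTrue (P x) → f x ∈ xs × IsTrue (Q (f x))) →
  (∀ {x y} → x ∈ xs → y ∈ xs → f x ≡ f y → x ≡ y) →
  countᵇ P xs ≤ countᵇ Q xs
countᵇ-≤ P Q f {xs} unique maps inj
  rewrite countᵇ-filter P xs | countᵇ-filter Q xs =
  length-≤-injection f (Unique.filter⁺ (λ x → T? (P x)) unique)
    (λ x∈ → let x∈xs , Px = ∈-filter⁻ (λ x → T? (P x)) x∈ ; fx∈xs , Qfx = maps x∈xs Px
            in ∈-filter⁺ (λ x → T? (Q x)) fx∈xs Qfx)
    (λ x∈ y∈ → inj (proj₁ (∈-filter⁻ (λ x → T? (P x)) x∈)) (proj₁ (∈-filter⁻ (λ x → T? (P x)) y∈)))

monicOf-Monic : ∀ {n} (v : Vec Bool n) → Monic n (monicOf v)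
monicOf-Monic []ᵛ      = one-monic
monicOf-Monic (a ∷ᵛ v) = ∷-monic a (monicOf-Monic v)

Monic⇒monicOf : ∀ {n p} → Monic n p → ∃[ v ] monicOf {n} v ≡ p
Monic⇒monicOf one-monic     = []ᵛ , refl
Monic⇒monicOf (∷-monic a m) with v , refl ← Monic⇒monicOf m = a ∷ᵛ v , refl

monicOf-injective : ∀ {n} {v w : Vec Bool n} → monicOf v ≡ monicOf w → v ≡ w
monicOf-injective {v = []ᵛ}     {[]ᵛ}     _  = refl
monicOf-injective {v = a ∷ᵛ v} {b ∷ᵛ w} eq =
  cong₂ _∷ᵛ_ (∷-injectiveˡ eq) (monicOf-injective (∷-injectiveʳ eq))

extend : ∀ {n} → Vec Bool n → List (Vec Bool (suc n))
extend v = (false ∷ᵛ v) ∷ (true ∷ᵛ v) ∷ []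

∈-allVecs : ∀ {n} (v : Vec Bool n) → v ∈ allVecs n
∈-allVecs []ᵛ          = here refl
∈-allVecs (false ∷ᵛ v) = ∈-concatMap⁺ extend (Any.map (λ { refl → here refl }) (∈-allVecs v))
∈-allVecs (true  ∷ᵛ v) = ∈-concatMap⁺ extend (Any.map (λ { refl → there (here refl) }) (∈-allVecs v))

∈-extend⇒tail-∈ : ∀ {n b} {v : Vec Bool n} {vs} → (b ∷ᵛ v) ∈ concatMap extend vs → v ∈ vs
∈-extend⇒tail-∈ b∷v∈ = Any.map (λ { (here refl) → refl ; (there (here refl)) → refl }) (∈-concatMap⁻ extend b∷v∈)

allVecs-unique : ∀ n → Unique (allVecs n)
allVecs-unique zero    = All.[] ∷ []
allVecs-unique (suc n) = extend-unique (allVecs-unique n)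
  where
  extend-unique : ∀ {vs} → Unique vs → Unique (concatMap extend vs)
  extend-unique []                       = []
  extend-unique {v ∷ vs} (v∉vs ∷ unique) =
    ((λ ()) All.∷ fresh false) ∷ fresh true ∷ extend-unique unique
    where
    fresh : ∀ b → All.All ((b ∷ᵛ v) ≢_) (concatMap extend vs)
    fresh b = All.tabulate λ { w∈ refl → All.lookup v∉vs (∈-extend⇒tail-∈ w∈) refl }

∈-monics⁺ : ∀ {n p} → Monic n p → p ∈ monics n
∈-monics⁺ m with v , refl ← Monic⇒monicOf m = ∈-map⁺ monicOf (∈-allVecs v)

∈-monics⁻ : ∀ {n p} → p ∈ monics n → Monic n p
∈-monics⁻ p∈ with v , _ , refl ← ∈-map⁻ monicOf p∈ = monicOf-Monic v

monics-unique : ∀ n → Unique (monics n)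
monics-unique n = Unique.map⁺ monicOf-injective (allVecs-unique n)

anyᵇ-witness : ∀ {A : Set} (P : A → Bool) xs → IsTrue (anyᵇ P xs) → ∃[ x ] x ∈ xs × IsTrue (P x)
anyᵇ-witness P (x ∷ xs) any with P x in Px
... | true  = x , here refl , subst IsTrue (sym Px) tt
... | false with y , y∈xs , Py ← anyᵇ-witness P xs any = y , there y∈xs , Py

anyᵇ-intro : ∀ {A : Set} (P : A → Bool) {x xs} → x ∈ xs → IsTrue (P x) → IsTrue (anyᵇ P xs)
anyᵇ-intro P {xs = y ∷ xs} (here refl) Px with P y
... | true = tt
anyᵇ-intro P {xs = y ∷ xs} (there x∈xs) Px with P y
... | true  = tt
... | false = anyᵇ-intro P x∈xs Px

==-sound : ∀ {p q} → IsTrue (p == q) → p ≡ q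
==-sound {[]}       {[]}       _ = refl
==-sound {true ∷ p}  {true ∷ q}  h = cong (true ∷_) (==-sound h)
==-sound {false ∷ p} {false ∷ q} h = cong (false ∷_) (==-sound h)

==-refl : ∀ p → IsTrue (p == p)
==-refl []          = tt
==-refl (true ∷ p)  = ==-refl p
==-refl (false ∷ p) = ==-refl p

record Factorisation (f : Poly) : Set where
  constructor factors
  field
    {a b} : ℕ
    {g h} : Poly
    g-monic : Monic (suc a) g
    h-monic : Monic (suc b) h
    product : g ⊛ h ≡ f

-- By definition, reducibleᵇ f = anyᵇ (factorTest f) (upTo (deg f ∸ 1)).
cofactorTest : Poly → ℕ → Poly → Bool
cofactorTest f d g = anyᵇ (λ h → (g ⊛ h) == f) (monics (deg f ∸ suc d))

factorTest : Poly → ℕ → Bool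
factorTest f d = anyᵇ (cofactorTest f d) (monics (suc d))

reducibleᵇ-intro : ∀ {f} d g h → d < deg f ∸ 1 → g ∈ monics (suc d) → h ∈ monics (deg f ∸ suc d) →
  g ⊛ h ≡ f → IsTrue (reducibleᵇ f)
reducibleᵇ-intro {f} d g h d< g∈ h∈ refl =
  anyᵇ-intro (factorTest f) (∈-upTo⁺ d<)
    (anyᵇ-intro (cofactorTest f d) g∈ (anyᵇ-intro (λ h → (g ⊛ h) == f) h∈ (==-refl f)))

Factorisation⇒reducibleᵇ : ∀ {f} → Factorisation f → IsTrue (reducibleᵇ f)
Factorisation⇒reducibleᵇ {f} (factors {a} {b} {g} {h} gm hm gh≡f) =
  reducibleᵇ-intro a g h (subst (λ D → a < D ∸ 1) (sym deg-f) (ℕ.m<m+n a (s≤s z≤n)))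
    (∈-monics⁺ gm) (subst (λ D → h ∈ monics (D ∸ suc a)) (sym deg-f) h∈) gh≡f
  where
  deg-f : deg f ≡ suc a + suc b
  deg-f = Monic-deg (subst (Monic _) gh≡f (Monic-⊛ gm hm))
  h∈ : h ∈ monics (suc a + suc b ∸ suc a)
  h∈ = subst (λ k → h ∈ monics k) (sym (ℕ.m+n∸m≡n (suc a) (suc b))) (∈-monics⁺ hm)

<⇒∸≡suc : ∀ {d m} → d < m → ∃[ b ] m ∸ d ≡ suc b
<⇒∸≡suc {zero}  {suc m} _         = m , refl
<⇒∸≡suc {suc d} {suc m} (s≤s d<m) = <⇒∸≡suc d<m

reducibleᵇ⇒Factorisation : ∀ {f} → IsTrue (reducibleᵇ f) → Factorisation f
reducibleᵇ⇒Factorisation {f} r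
  with d , d∈ , r₁ ← anyᵇ-witness (factorTest f) (upTo (deg f ∸ 1)) r
  with g , g∈ , r₂ ← anyᵇ-witness (cofactorTest f d) (monics (suc d)) r₁
  with h , h∈ , gh==f ← anyᵇ-witness (λ h → (g ⊛ h) == f) (monics (deg f ∸ suc d)) r₂
  with b , D∸d≡ ← <⇒∸≡suc (∈-upTo⁻ d∈)
  = factors (∈-monics⁻ g∈) (subst (λ k → Monic k h) h-deg (∈-monics⁻ h∈)) (==-sound gh==f)
  where
  h-deg : deg f ∸ suc d ≡ suc b
  h-deg = trans (sym (ℕ.∸-+-assoc (deg f) 1 d)) D∸d≡

irreducibleᵇ⇒¬Factorisation : ∀ {f} → IsTrue (irreducibleᵇ f) → ¬ Factorisation f
irreducibleᵇ⇒¬Factorisation {f} irr fac with reducibleᵇ f | Factorisation⇒reducibleᵇ fac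
... | true | _ = proj₂ (Equivalence.to T-∧ irr)

¬Factorisation⇒irreducibleᵇ : ∀ {n f} → Monic (suc n) f → ¬ Factorisation f → IsTrue (irreducibleᵇ f)
¬Factorisation⇒irreducibleᵇ {n} {f} m ¬fac =
  Equivalence.from T-∧ (ℕ.≤⇒≤ᵇ (subst (1 ≤_) (sym (Monic-deg m)) (s≤s z≤n)) , not-reducible)
  where
  not-reducible : IsTrue (not (reducibleᵇ f))
  not-reducible with reducibleᵇ f in r
  ... | false = tt
  ... | true  = ¬fac (reducibleᵇ⇒Factorisation (subst IsTrue (sym r) tt))

≤-+-≡⇒≡ : ∀ {k l m n} → k ≤ m → l ≤ n → m + n ≡ k + l → k ≡ m × l ≡ n
≤-+-≡⇒≡ {k} {l} {m} {n} k≤m l≤n m+n≡k+l = k≡m , ℕ.+-cancelˡ-≡ m l n (sym (subst (λ j → m + n ≡ j + l) k≡m m+n≡k+l))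
  where
  k≡m : k ≡ m
  k≡m = ℕ.≤-antisym k≤m (ℕ.+-cancelʳ-≤ n m k (ℕ.≤-trans (ℕ.≤-reflexive m+n≡k+l) (ℕ.+-monoʳ-≤ k l≤n)))

factorisation-≋ : ∀ {a b f P Q} → Monic (suc a + suc b) f → f ≋ P ⊛ Q →
  Deg< (suc (suc a)) P → Deg< (suc (suc b)) Q → Factorisation f
factorisation-≋ {a} {b} {f} {P} {Q} mf f≋PQ dP dQ with ≋[]-or-monic P | ≋[]-or-monic Q
... | inj₁ P≋[] | _        = ⊥-elim (Monic≉[] mf (≋-trans f≋PQ (⊛-zeroˡ Q P≋[])))
... | inj₂ _    | inj₁ Q≋[] = ⊥-elim (Monic≉[] mf (≋-trans f≋PQ (≋-trans (⊛-congˡ P Q≋[]) (⊛-zeroʳ P))))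
... | inj₂ (k , mP) | inj₂ (l , mQ) =
  factors (subst (λ j → Monic j (norm P)) k≡ mP) (subst (λ j → Monic j (norm Q)) l≡ mQ) (sym f≡)
  where
  f≡ : f ≡ norm P ⊛ norm Q
  f≡ = Monic-≋⇒≡ mf (Monic-⊛ mP mQ) (≋-trans f≋PQ (⊛-cong (≋-sym (norm-≋ P)) (≋-sym (norm-≋ Q))))
  degrees : k ≡ suc a × l ≡ suc b
  degrees = ≤-+-≡⇒≡ (ℕ.≤-pred (Monic-Deg< mP (Deg<-resp-≋ (≋-sym (norm-≋ P)) dP)))
                        (ℕ.≤-pred (Monic-Deg< mQ (Deg<-resp-≋ (≋-sym (norm-≋ Q)) dQ)))
                        (Monic-deg-unique mf (subst (Monic _) (sym f≡) (Monic-⊛ mP mQ)))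
  k≡ = proj₁ degrees
  l≡ = proj₂ degrees

-- The bijection ψ on monic irreducibles of degree N

ψ : ℕ → Poly → Poly
ψ n f = norm (Ψ n f)

Ψ²-ψ : ∀ n {f} → Deg< (suc n) f → Ψ n (Ψ n (ψ n f)) ≋ f
Ψ²-ψ n {f} d = ≋-trans (Ψ-cong n (Ψ-cong n (norm-≋ (Ψ n f)))) (Ψ³ n d)

ψ-injective : ∀ {n f g} → Monic n f → Monic n g → ψ n f ≡ ψ n g → f ≡ g
ψ-injective {n} {f} {g} mf mg ψf≡ψg = Monic-≋⇒≡ mf mg (begin
  f                  ≈⟨ Ψ²-ψ n (Monic⇒Deg< mf) ⟨
  Ψ n (Ψ n (ψ n f))  ≡⟨ cong (λ r → Ψ n (Ψ n r)) ψf≡ψg ⟩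
  Ψ n (Ψ n (ψ n g))  ≈⟨ Ψ²-ψ n (Monic⇒Deg< mg) ⟩
  g                  ∎)
  where open ≋-Reasoning

ψ-monic : ∀ n {f} → Monic (suc (suc n)) f → ¬ Factorisation f → Monic (suc (suc n)) (ψ (suc (suc n)) f)
ψ-monic n {f} mf ¬fac = Deg<-exact (Deg<-Ψ N (Monic⇒Deg< mf)) λ low →
  ¬fac (factorisation-≋ mf (T+1-divides low) Deg<-T+1 (Deg<-Ψ (suc n) (Deg<-Ψ (suc n) low)))
  where
  N = suc (suc n)
  X = Ψ N f
  -- If deg Ψ f < N then T divides Ψ f, so Ψ₁ T = T + 1 divides f = Ψ (Ψ (Ψ f)).
  T+1-divides : Deg< N X → f ≋ T+1 ⊛ Ψ (suc n) (Ψ (suc n) X)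
  T+1-divides low = begin
    f                                        ≈⟨ Ψ³ N (Monic⇒Deg< mf) ⟨
    Ψ N (Ψ N X)                              ≈⟨ Ψ-cong N (Ψ-suc (suc n) low) ⟩
    Ψ N (false ∷ Ψ (suc n) X)                ≈⟨ Ψ-cong N (T-⊛ (Ψ (suc n) X)) ⟨
    Ψ (1 + suc n) (T ⊛ Ψ (suc n) X)          ≈⟨ Ψ-⊛ 1 (suc n) (Deg<-T^ 1) (Deg<-Ψ (suc n) low) ⟩
    Ψ 1 T ⊛ Ψ (suc n) (Ψ (suc n) X)          ≈⟨ ⊛-congʳ (Ψ (suc n) (Ψ (suc n) X)) Ψ-T ⟩
    T+1 ⊛ Ψ (suc n) (Ψ (suc n) X)            ∎
    where open ≋-Reasoning

ψ-¬Factorisation : ∀ {N f} → Monic N f → Monic N (ψ N f) → ¬ Factorisation f → ¬ Factorisation (ψ N f)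
ψ-¬Factorisation {N} {f} mf mψ ¬fac (factors {a} {b} {g} {h} gm hm gh≡ψf)
  with refl ← Monic-deg-unique mψ (subst (Monic _) gh≡ψf (Monic-⊛ gm hm)) =
  ¬fac (factorisation-≋ mf f≋ (Deg<-Ψ (suc a) (Deg<-Ψ (suc a) dg)) (Deg<-Ψ (suc b) (Deg<-Ψ (suc b) dh)))
  where
  dg = Monic⇒Deg< gm
  dh = Monic⇒Deg< hm
  f≋ : f ≋ Ψ (suc a) (Ψ (suc a) g) ⊛ Ψ (suc b) (Ψ (suc b) h)
  f≋ = begin
    f                                          ≈⟨ Ψ²-ψ N (Monic⇒Deg< mf) ⟨
    Ψ N (Ψ N (ψ N f))                          ≡⟨ cong (λ r → Ψ N (Ψ N r)) gh≡ψf ⟨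
    Ψ N (Ψ N (g ⊛ h))                          ≈⟨ Ψ-cong N (Ψ-⊛ (suc a) (suc b) dg dh) ⟩
    Ψ N (Ψ (suc a) g ⊛ Ψ (suc b) h)            ≈⟨ Ψ-⊛ (suc a) (suc b) (Deg<-Ψ (suc a) dg) (Deg<-Ψ (suc b) dh) ⟩
    Ψ (suc a) (Ψ (suc a) g) ⊛ Ψ (suc b) (Ψ (suc b) h) ∎
    where open ≋-Reasoning

ψ-irreducible : ∀ {N f} → 2 ≤ N → Monic N f → IsTrue (irreducibleᵇ f) →
  Monic N (ψ N f) × IsTrue (irreducibleᵇ (ψ N f))
ψ-irreducible {suc (suc n)} {f} (s≤s (s≤s z≤n)) mf irr =
  mψ , ¬Factorisation⇒irreducibleᵇ mψ (ψ-¬Factorisation mf mψ ¬fac)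
  where
  ¬fac : ¬ Factorisation f
  ¬fac = irreducibleᵇ⇒¬Factorisation irr
  mψ : Monic (suc (suc n)) (ψ (suc (suc n)) f)
  mψ = ψ-monic n mf ¬fac

ev-ψ : ∀ n {f} → Deg< (suc n) f → ev (ψ n f) ≡ α^ n *₈ (ev f *₈ ev f)
ev-ψ n {f} d = trans (ev-cong (norm-≋ (Ψ n f))) (ev-Ψ n d)

π-≤ : ∀ {N} → 2 ≤ N → N % 7 ≡ 1 → ∀ c c′ → α *₈ (ev c *₈ ev c) ≡ ev c′ → π N mPoly c ≤ π N mPoly c′
π-≤ {N} 2≤N N%7≡1 c c′ αc²≡c′ = countᵇ-≤ _ _ (ψ N) (monics-unique N) maps
  (λ f∈ g∈ → ψ-injective (∈-monics⁻ f∈) (∈-monics⁻ g∈))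
  where
  maps : ∀ {f} → f ∈ monics N → IsTrue (irreducibleᵇ f ∧ congᵇ f c mPoly) →
         ψ N f ∈ monics N × IsTrue (irreducibleᵇ (ψ N f) ∧ congᵇ (ψ N f) c′ mPoly)
  maps {f} f∈ irr∧f≡c
    with irr , f≡c ← Equivalence.to T-∧ irr∧f≡c
    with mψ , irrψ ← ψ-irreducible 2≤N (∈-monics⁻ f∈) irr =
    ∈-monics⁺ mψ , Equivalence.from T-∧ (irrψ , Equivalence.from (congᵇ-mPoly⇔ev≡ (ψ N f) c′) (begin
      ev (ψ N f)                ≡⟨ ev-ψ N (Monic⇒Deg< (∈-monics⁻ f∈)) ⟩
      α^ N *₈ (ev f *₈ ev f)    ≡⟨ cong₂ (λ u v → u *₈ (v *₈ v)) (α^-≡1-mod-7 N N%7≡1) (Equivalence.to (congᵇ-mPoly⇔ev≡ f c) f≡c) ⟩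
      α *₈ (ev c *₈ ev c)       ≡⟨ αc²≡c′ ⟩
      ev c′                     ∎))
    where open ≡-Reasoning

≤-cycle : ∀ {a b c} → a ≤ b → b ≤ c → c ≤ a → a ≡ b × b ≡ c
≤-cycle a≤b b≤c c≤a = ℕ.≤-antisym a≤b (ℕ.≤-trans b≤c c≤a) , ℕ.≤-antisym b≤c (ℕ.≤-trans c≤a a≤b)

mainTheorem9 : (N : ℕ) → 2 ≤ N → N % 7 ≡ 1 →
    (π N mPoly one ≡ π N mPoly T × π N mPoly T ≡ π N mPoly T+1)
    × (π N mPoly T² ≡ π N mPoly T²+T × π N mPoly T²+T ≡ π N mPoly T²+T+1)
mainTheorem9 N 2≤N N%7≡1 =
  ≤-cycle (step one T refl) (step T T+1 refl) (step T+1 one refl) ,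
  (trans T²≡T²+T+1 T²+T+1≡T²+T , sym T²+T+1≡T²+T)
  where
  step : ∀ c c′ → α *₈ (ev c *₈ ev c) ≡ ev c′ → π N mPoly c ≤ π N mPoly c′
  step = π-≤ 2≤N N%7≡1
  T²-cycle : π N mPoly T² ≡ π N mPoly T²+T+1 × π N mPoly T²+T+1 ≡ π N mPoly T²+T
  T²-cycle = ≤-cycle (step T² T²+T+1 refl) (step T²+T+1 T²+T refl) (step T²+T T² refl)
  T²≡T²+T+1 = proj₁ T²-cycle
  T²+T+1≡T²+T = proj₂ T²-cycle
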